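{- Let $n\ge 4$ and $2\le k\le n-2$. Let $\mathfrak{d}^e_{n,k}$ (resp. $\mathfrak{d}^o_{n,k}$) be the number of even (resp. odd) parity alternating derangements of $[n]$ with exactly $k$ excedances, and let $d^e_{m,i}$ (resp. $d^o_{m,i}$) be the number of even (resp. odd) derangements of $[m]$ with exactly $i$ excedances. Write $a=\lceil n/2\rceil$, $b=\lfloor n/2\rfloor$. Then \[ \mathfrak{d}^e_{n,k}=\begin{cases}\displaystyle\sum_{i=1}^{k-1}\big(d^e_{a,i}d^e_{b,k-i}+d^o_{a,i}d^o_{b,k-i}\big), & 2\le k\le b,\\[2mm] \displaystyle\sum_{i=1}^{n-k-1}\big(d^e_{a,i}d^e_{b,n-k-i}+d^o_{a,i}d^o_{b,n-k-i}\big), & b<k\le n-2,\end{cases} \] \[ \mathfrak{d}^o_{n,k}=\begin{cases}\displaystyle\sum_{i=1}^{k-1}\big(d^e_{a,i}d^o_{b,k-i}+d^o_{a,i}d^e_{b,k-i}\big), & 2\le k\le b,\\[2mm] \displaystyle\sum_{i=1}^{n-k-1}\big(d^e_{a,i}d^o_{b,n-k-i}+d^o_{a,i}d^e_{b,n-k-i}\big), & b<k\le n-2.\end{cases} \]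
   Context: A permutation $\sigma$ of $[n]=\{1,\dots,n\}$, in one-line notation, is a PAP if $\sigma(i)\equiv i\pmod 2$ for all $i$ (entries alternate in parity, first entry odd); a parity alternating derangement is a PAP with $\sigma(i)\ne i$ for all $i$. An excedance of $\sigma$ is an index $i$ with $\sigma(i)>i$. A permutation of $[m]$ is even or odd according to its sign $(-1)^{m-c}$, $c$ its number of cycles (fixed points included). Counts $d^e_{m,i},d^o_{m,i}$ are $0$ when no such derangement exists. -}

module Defs where

open import Data.Bool using (Bool; true; false; _∧_; not; if_then_else_)
open import Data.Nat using (ℕ; zero; suc; _+_; _∸_; _%_; _≡ᵇ_; _<ᵇ_; _≤ᵇ_)
open import Data.Fin using (Fin; toℕ)
open import Data.List using (List; []; _∷_; map; concatMap; length; filterᵇ; allFin)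
open import Data.Bool.ListAction using (and)
open import Data.Vec using (Vec; []; _∷_; lookup)

-- One-line notation: a map [m] → [n] is a vector of length m with entries in Fin n.
-- Positions and values are 0-indexed (Fin n stands for {1..n} shifted by one);
-- parity agreement and excedances are invariant under this common shift.

allMaps : (m n : ℕ) → List (Vec (Fin n) m)
allMaps zero    n = [] ∷ []
allMaps (suc m) n = concatMap (λ v → map (λ x → x ∷ v) (allFin n)) (allMaps m n)

module _ {n : ℕ} (σ : Vec (Fin n) n) where

  app : Fin n → Fin n
  app i = lookup σ i

  -- injectivity (hence bijectivity, on a finite set of equal size)
  isPermᵇ : Bool
  isPermᵇ = and (concatMap (λ i → map (λ j →
              if toℕ i ≡ᵇ toℕ j then true else not (toℕ (app i) ≡ᵇ toℕ (app j)))
              (allFin n)) (allFin n))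

  isDerangementᵇ : Bool
  isDerangementᵇ = and (map (λ i → not (toℕ (app i) ≡ᵇ toℕ i)) (allFin n))

  isPAPᵇ : Bool
  isPAPᵇ = and (map (λ i → (toℕ (app i) % 2) ≡ᵇ (toℕ i % 2)) (allFin n))

  exc : ℕ
  exc = length (filterᵇ (λ i → toℕ i <ᵇ toℕ (app i)) (allFin n))

  iter : ℕ → Fin n → Fin n
  iter zero    i = i
  iter (suc j) i = app (iter j i)

  -- i is the least element of its cycle: σ^j(i) ≥ i for j = 1..n
  -- (every cycle has length ≤ n, so this ranges over the whole cycle)
  isCycleMinᵇ : Fin n → Bool
  isCycleMinᵇ i = and (map (λ j → toℕ i ≤ᵇ toℕ (iter (suc (toℕ j)) i)) (allFin n))

  -- number of cycles (fixed points included) = number of cycle minima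
  cycles : ℕ
  cycles = length (filterᵇ isCycleMinᵇ (allFin n))

  -- σ is even iff n - c is even (sign (-1)^(n-c))
  isEvenᵇ : Bool
  isEvenᵇ = ((n ∸ cycles) % 2) ≡ᵇ 0

perms : (n : ℕ) → List (Vec (Fin n) n)
perms n = filterᵇ isPermᵇ (allMaps n n)

d : Bool → ℕ → ℕ → ℕ
d e m i = length (filterᵇ (λ σ → isDerangementᵇ σ ∧ (exc σ ≡ᵇ i) ∧ (isEvenᵇ σ ≡ᵇB e)) (perms m))
  where
  _≡ᵇB_ : Bool → Bool → Bool
  true  ≡ᵇB b = b
  false ≡ᵇB b = not b

pd : Bool → ℕ → ℕ → ℕ
pd e n k = length (filterᵇ (λ σ → isPAPᵇ σ ∧ isDerangementᵇ σ ∧ (exc σ ≡ᵇ k) ∧ (isEvenᵇ σ ≡ᵇB e)) (perms n))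
  where
  _≡ᵇB_ : Bool → Bool → Bool
  true  ≡ᵇB b = b
  false ≡ᵇB b = not b

dᵉ dᵒ 𝔡ᵉ 𝔡ᵒ : ℕ → ℕ → ℕ
dᵉ = d true
dᵒ = d false
𝔡ᵉ = pd true
𝔡ᵒ = pd false

sum1to : ℕ → (ℕ → ℕ) → ℕ
sum1to zero    f = 0
sum1to (suc K) f = sum1to K f + f (suc K)

{-# OPTIONS --safe #-}
module Submission where

-- A parity alternating permutation σ of [n] maps odd positions to odd ones and even to even, so it induces
-- permutations τ₁ of the ⌈n/2⌉ odd and τ₂ of the ⌊n/2⌋ even positions, and σ ↦ (τ₁, τ₂) is a bijection.
-- σ is a derangement iff τ₁ and τ₂ are, and since i ↦ 2i and i ↦ 2i + 1 are order embeddings, the excedances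
-- and the cycles of σ are those of τ₁ together with those of τ₂; hence exc σ = exc τ₁ + exc τ₂ and
-- sign σ = sign τ₁ · sign τ₂. Splitting k = i + (k − i) by the excedance number i ≥ 1 of the (nonempty)
-- derangement τ₁ gives the first formula, for every k. The second follows by passing to σ⁻¹, which is again
-- a parity alternating derangement of the same sign, with n − k excedances.

open import Defs
open import Data.Nat using (ℕ; _+_; _*_; _∸_; _≤_; _<_; ⌈_/2⌉; ⌊_/2⌋)
open import Data.Product using (_×_)
open import Relation.Binary.PropositionalEquality using (_≡_)

open import Data.Bool using (Bool; true; false; _∧_; not; if_then_else_; T)
open import Data.Bool.ListAction using (and)
open import Data.Bool.Properties using (T-≡; T-∧; ∧-zeroʳ; ∧-identityʳ; not-involutive)
open import Data.Empty using (⊥-elim)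
open import Data.Fin using (Fin; zero; suc; toℕ; fromℕ<)
import Data.Fin as Fin
open import Data.Fin.Properties using (toℕ-injective; toℕ<n; toℕ-fromℕ<; pigeonhole; any?) renaming (_≟_ to _≟ᶠ_)
open import Data.List using (List; []; _∷_; map; length; filterᵇ; _++_; concatMap; tabulate; allFin; cartesianProduct)
open import Data.List.Relation.Unary.All using (All; []; _∷_)
open import Data.List.Relation.Unary.All.Properties using (tabulate⁺; tabulate⁻; map⁺; map⁻; concat⁺; concat⁻)
open import Data.Nat using (zero; suc; _≡ᵇ_; _<ᵇ_; _%_; _/_; z≤n; s≤s; s≤s⁻¹)
open import Data.Nat.DivMod using (m≡m%n+[m/n]*n; m%n<n; m*n%n≡0; [m+kn]%n≡m%n)
open import Data.Nat.Properties
open import Algebra.Properties.CommutativeSemigroup +-commutativeSemigroup using (interchange; x∙yz≈y∙xz)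
open import Data.Product using (∃-syntax; _,_; proj₁; proj₂; uncurry)
import Data.Product.Properties as Product
open import Data.Sum using (_⊎_; inj₁; inj₂; [_,_]; fromInj₁; fromInj₂)
import Data.Sum as Sum
open import Data.Sum.Properties using (inj₁-injective; inj₂-injective)
open import Data.Vec using (Vec; []; _∷_; lookup)
import Data.Vec as Vec
import Data.Vec.Properties as Vec
open import Function using (_∘_; id; _⇔_; mk⇔; Equivalence)
open import Function.Definitions using (Injective)
open import Relation.Binary.Definitions using (DecidableEquality)
open import Relation.Binary.PropositionalEquality using (_≢_; refl; sym; trans; cong; cong₂; subst; module ≡-Reasoning)
open import Relation.Nullary using (¬_; Dec; yes; no; does; _×-dec_)
open import Relation.Nullary.Decidable using (dec-true; dec-false; does-⇔)

private variable
  A B : Set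

≡true⇒T : ∀ {b} → b ≡ true → T b
≡true⇒T = Equivalence.from T-≡

T⇒≡true : ∀ {b} → T b → b ≡ true
T⇒≡true = Equivalence.to T-≡

T-ext : ∀ {b c} → (T b → T c) → (T c → T b) → b ≡ c
T-ext {false} {false} _ _ = refl
T-ext {false} {true}  _ g = ⊥-elim (g _)
T-ext {true}  {false} f _ = ⊥-elim (f _)
T-ext {true}  {true}  _ _ = refl

T-does⇒ : ∀ {P : Set} (a? : Dec P) → T (does a?) → P
T-does⇒ (yes a) _ = a

T-not-does⇒ : ∀ {P : Set} (a? : Dec P) → T (not (does a?)) → ¬ P
T-not-does⇒ (no ¬a) _ = ¬a

¬⇒T-not-does : ∀ {P : Set} (a? : Dec P) → ¬ P → T (not (does a?))
¬⇒T-not-does (yes a) ¬a = ¬a a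
¬⇒T-not-does (no _)  _  = _

𝟙 : Bool → ℕ
𝟙 true  = 1
𝟙 false = 0

𝟙-∧ : ∀ a b → 𝟙 (a ∧ b) ≡ 𝟙 a * 𝟙 b
𝟙-∧ true  b = sym (+-identityʳ (𝟙 b))
𝟙-∧ false b = refl

𝟙-∧-≡1 : ∀ {a b} → T a → T b → 𝟙 (a ∧ b) ≡ 1
𝟙-∧-≡1 {true} {true} _ _ = refl

𝟙-∧-≡0 : ∀ a {b} → (T a → ¬ T b) → 𝟙 (a ∧ b) ≡ 0
𝟙-∧-≡0 false     _ = refl
𝟙-∧-≡0 true {b} f with b
... | false = refl
... | true  = ⊥-elim (f _ _)

xnor : Bool → Bool → Bool
xnor true  b = b
xnor false b = not b

xnor-not : ∀ a b → xnor (not a) b ≡ xnor a (not b)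
xnor-not true  b = refl
xnor-not false b = sym (not-involutive b)

𝟙-∧-true : ∀ b → 𝟙 (b ∧ true) ≡ 𝟙 b
𝟙-∧-true b = cong 𝟙 (∧-identityʳ b)

𝟙-∧-false : ∀ b → 𝟙 (b ∧ false) ≡ 0
𝟙-∧-false b = cong 𝟙 (∧-zeroʳ b)

T-∧⁻ : ∀ {a b} → T (a ∧ b) → T a × T b
T-∧⁻ {a} = Equivalence.to (T-∧ {a})

T-∧⁺ : ∀ {a b} → T a → T b → T (a ∧ b)
T-∧⁺ ta tb = Equivalence.from T-∧ (ta , tb)

∧-congˡ-T : ∀ a {b c} → (T a → b ≡ c) → a ∧ b ≡ a ∧ c
∧-congˡ-T false _   = refl
∧-congˡ-T true  b≡c = b≡c _

even%-suc : ∀ x → (suc x % 2 ≡ᵇ 0) ≡ not (x % 2 ≡ᵇ 0)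
even%-suc zero          = refl
even%-suc (suc zero)    = refl
even%-suc (suc (suc x)) = even%-suc x

even%-+ : ∀ x y → ((x + y) % 2 ≡ᵇ 0) ≡ xnor (x % 2 ≡ᵇ 0) (y % 2 ≡ᵇ 0)
even%-+ zero          y = refl
even%-+ (suc zero)    y = even%-suc y
even%-+ (suc (suc x)) y = even%-+ x y

[m+n]∸[o+p]≡[m∸o]+[n∸p] : ∀ {m n o p} → o ≤ m → p ≤ n → (m + n) ∸ (o + p) ≡ (m ∸ o) + (n ∸ p)
[m+n]∸[o+p]≡[m∸o]+[n∸p] {m} {n} {o} {p} o≤m p≤n = begin
  (m + n) ∸ (o + p)  ≡⟨ ∸-+-assoc (m + n) o p ⟨
  (m + n) ∸ o ∸ p    ≡⟨ cong (_∸ p) (+-∸-comm n o≤m) ⟩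
  (m ∸ o) + n ∸ p    ≡⟨ +-∸-assoc (m ∸ o) p≤n ⟩
  (m ∸ o) + (n ∸ p)  ∎
  where open ≡-Reasoning

𝟙<ᵇ+𝟙>ᵇ≡1 : ∀ {m n} → m ≢ n → 𝟙 (m <ᵇ n) + 𝟙 (n <ᵇ m) ≡ 1
𝟙<ᵇ+𝟙>ᵇ≡1 {zero}  {zero}  m≢n = ⊥-elim (m≢n refl)
𝟙<ᵇ+𝟙>ᵇ≡1 {zero}  {suc n} _   = refl
𝟙<ᵇ+𝟙>ᵇ≡1 {suc m} {zero}  _   = refl
𝟙<ᵇ+𝟙>ᵇ≡1 {suc m} {suc n} m≢n = 𝟙<ᵇ+𝟙>ᵇ≡1 (m≢n ∘ cong suc)

<⇒≤∸1 : ∀ {m n} → m < n → m ≤ n ∸ 1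
<⇒≤∸1 (s≤s m≤n) = m≤n

∑ : List A → (A → ℕ) → ℕ
∑ []       F = 0
∑ (x ∷ xs) F = F x + ∑ xs F

syntax ∑ xs (λ x → F) = ∑[ x ∈ xs ] F

∑-cong : ∀ (xs : List A) {F G : A → ℕ} → (∀ x → F x ≡ G x) → ∑ xs F ≡ ∑ xs G
∑-cong []       _   = refl
∑-cong (x ∷ xs) F≡G = cong₂ _+_ (F≡G x) (∑-cong xs F≡G)

∑-zero : ∀ (xs : List A) → ∑[ x ∈ xs ] 0 ≡ 0
∑-zero []       = refl
∑-zero (x ∷ xs) = ∑-zero xs

∑-distrib-+ : ∀ (xs : List A) F G → ∑[ x ∈ xs ] (F x + G x) ≡ ∑ xs F + ∑ xs G
∑-distrib-+ []       F G = refl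
∑-distrib-+ (x ∷ xs) F G =
  trans (cong (F x + G x +_) (∑-distrib-+ xs F G)) (interchange (F x) (G x) (∑ xs F) (∑ xs G))

∑-distribˡ-* : ∀ (xs : List A) c F → ∑[ x ∈ xs ] (c * F x) ≡ c * ∑ xs F
∑-distribˡ-* []       c F = sym (*-zeroʳ c)
∑-distribˡ-* (x ∷ xs) c F =
  trans (cong (c * F x +_) (∑-distribˡ-* xs c F)) (sym (*-distribˡ-+ c (F x) (∑ xs F)))

∑-distribʳ-* : ∀ (xs : List A) c F → ∑[ x ∈ xs ] (F x * c) ≡ ∑ xs F * c
∑-distribʳ-* []       c F = refl
∑-distribʳ-* (x ∷ xs) c F =
  trans (cong (F x * c +_) (∑-distribʳ-* xs c F)) (sym (*-distribʳ-+ c (F x) (∑ xs F)))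

∑-comm : ∀ (xs : List A) (ys : List B) (F : A → B → ℕ) → ∑[ x ∈ xs ] ∑[ y ∈ ys ] F x y ≡ ∑[ y ∈ ys ] ∑[ x ∈ xs ] F x y
∑-comm []       ys F = sym (∑-zero ys)
∑-comm (x ∷ xs) ys F =
  trans (cong (∑ ys (F x) +_) (∑-comm xs ys F)) (sym (∑-distrib-+ ys (F x) (λ y → ∑[ x ∈ xs ] F x y)))

∑-product : ∀ (xs : List A) (ys : List B) F G → ∑[ x ∈ xs ] ∑[ y ∈ ys ] (F x * G y) ≡ ∑ xs F * ∑ ys G
∑-product xs ys F G = trans (∑-cong xs (λ x → ∑-distribˡ-* ys (F x) G)) (∑-distribʳ-* xs (∑ ys G) F)

∑-product-+ : ∀ (xs : List A) (ys : List B) F₁ G₁ F₂ G₂ →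
  ∑[ x ∈ xs ] ∑[ y ∈ ys ] (F₁ x * G₁ y + F₂ x * G₂ y) ≡ ∑ xs F₁ * ∑ ys G₁ + ∑ xs F₂ * ∑ ys G₂
∑-product-+ xs ys F₁ G₁ F₂ G₂ = begin
  ∑[ x ∈ xs ] ∑[ y ∈ ys ] (F₁ x * G₁ y + F₂ x * G₂ y)
    ≡⟨ ∑-cong xs (λ x → ∑-distrib-+ ys (λ y → F₁ x * G₁ y) (λ y → F₂ x * G₂ y)) ⟩
  ∑[ x ∈ xs ] (∑[ y ∈ ys ] (F₁ x * G₁ y) + ∑[ y ∈ ys ] (F₂ x * G₂ y))
    ≡⟨ ∑-distrib-+ xs _ _ ⟩
  ∑[ x ∈ xs ] ∑[ y ∈ ys ] (F₁ x * G₁ y) + ∑[ x ∈ xs ] ∑[ y ∈ ys ] (F₂ x * G₂ y)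
    ≡⟨ cong₂ _+_ (∑-product xs ys F₁ G₁) (∑-product xs ys F₂ G₂) ⟩
  ∑ xs F₁ * ∑ ys G₁ + ∑ xs F₂ * ∑ ys G₂ ∎
  where open ≡-Reasoning

∑-++ : ∀ (xs ys : List A) F → ∑ (xs ++ ys) F ≡ ∑ xs F + ∑ ys F
∑-++ []       ys F = refl
∑-++ (x ∷ xs) ys F = trans (cong (F x +_) (∑-++ xs ys F)) (sym (+-assoc (F x) (∑ xs F) (∑ ys F)))

∑-map : ∀ (f : A → B) xs F → ∑ (map f xs) F ≡ ∑[ x ∈ xs ] F (f x)
∑-map f []       F = refl
∑-map f (x ∷ xs) F = cong (F (f x) +_) (∑-map f xs F)

∑-concatMap : ∀ (g : A → List B) xs F → ∑ (concatMap g xs) F ≡ ∑[ x ∈ xs ] ∑ (g x) F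
∑-concatMap g []       F = refl
∑-concatMap g (x ∷ xs) F = trans (∑-++ (g x) (concatMap g xs) F) (cong (∑ (g x) F +_) (∑-concatMap g xs F))

∑-cartesianProduct : ∀ (xs : List A) (ys : List B) F →
  ∑ (cartesianProduct xs ys) F ≡ ∑[ x ∈ xs ] ∑[ y ∈ ys ] F (x , y)
∑-cartesianProduct []       ys F = refl
∑-cartesianProduct (x ∷ xs) ys F =
  trans (∑-++ (map (x ,_) ys) (cartesianProduct xs ys) F)
        (cong₂ _+_ (∑-map (x ,_) ys F) (∑-cartesianProduct xs ys F))

length-filterᵇ : ∀ (p : A → Bool) xs → length (filterᵇ p xs) ≡ ∑[ x ∈ xs ] 𝟙 (p x)
length-filterᵇ p []       = refl
length-filterᵇ p (x ∷ xs) with p x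
... | true  = cong suc (length-filterᵇ p xs)
... | false = length-filterᵇ p xs

length-filterᵇ-filterᵇ : ∀ (p q : A → Bool) xs →
  length (filterᵇ p (filterᵇ q xs)) ≡ ∑[ x ∈ xs ] 𝟙 (q x ∧ p x)
length-filterᵇ-filterᵇ p q []       = refl
length-filterᵇ-filterᵇ p q (x ∷ xs) with q x
... | false = length-filterᵇ-filterᵇ p q xs
... | true with p x
...   | true  = cong suc (length-filterᵇ-filterᵇ p q xs)
...   | false = length-filterᵇ-filterᵇ p q xs

sumFin : ∀ n → (Fin n → ℕ) → ℕ
sumFin zero    F = 0
sumFin (suc n) F = F zero + sumFin n (F ∘ suc)

syntax sumFin n (λ i → F) = ∑[ i < n ] F

sumFin-cong : ∀ n {F G : Fin n → ℕ} → (∀ i → F i ≡ G i) → sumFin n F ≡ sumFin n G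
sumFin-cong zero    _   = refl
sumFin-cong (suc n) F≡G = cong₂ _+_ (F≡G zero) (sumFin-cong n (F≡G ∘ suc))

sumFin-zero : ∀ n → ∑[ i < n ] 0 ≡ 0
sumFin-zero zero    = refl
sumFin-zero (suc n) = sumFin-zero n

sumFin-const-1 : ∀ n → ∑[ i < n ] 1 ≡ n
sumFin-const-1 zero    = refl
sumFin-const-1 (suc n) = cong suc (sumFin-const-1 n)

sumFin-𝟙≤ : ∀ n (p : Fin n → Bool) → ∑[ i < n ] 𝟙 (p i) ≤ n
sumFin-𝟙≤ zero    p = z≤n
sumFin-𝟙≤ (suc n) p with p zero
... | true  = s≤s (sumFin-𝟙≤ n (p ∘ suc))
... | false = m≤n⇒m≤1+n (sumFin-𝟙≤ n (p ∘ suc))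

∑-tabulate : ∀ {n} (g : Fin n → A) F → ∑ (tabulate g) F ≡ ∑[ i < n ] F (g i)
∑-tabulate {n = zero}  g F = refl
∑-tabulate {n = suc n} g F = cong (F (g zero) +_) (∑-tabulate (g ∘ suc) F)

length-filterᵇ-allFin : ∀ n (p : Fin n → Bool) → length (filterᵇ p (allFin n)) ≡ ∑[ i < n ] 𝟙 (p i)
length-filterᵇ-allFin n p = trans (length-filterᵇ p (allFin n)) (∑-tabulate id (𝟙 ∘ p))

sum1to-cong : ∀ K {F G : ℕ → ℕ} → (∀ i → F i ≡ G i) → sum1to K F ≡ sum1to K G
sum1to-cong zero    _   = refl
sum1to-cong (suc K) F≡G = cong₂ _+_ (sum1to-cong K F≡G) (F≡G (suc K))

sum1to-zero : ∀ K {F : ℕ → ℕ} → (∀ i → F i ≡ 0) → sum1to K F ≡ 0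
sum1to-zero zero    _    = refl
sum1to-zero (suc K) F≡0 = cong₂ _+_ (sum1to-zero K F≡0) (F≡0 (suc K))

∑-sum1to-comm : ∀ (xs : List A) K (F : A → ℕ → ℕ) → ∑[ x ∈ xs ] sum1to K (F x) ≡ sum1to K (λ i → ∑[ x ∈ xs ] F x i)
∑-sum1to-comm xs zero    F = ∑-zero xs
∑-sum1to-comm xs (suc K) F =
  trans (∑-distrib-+ xs (λ x → sum1to K (F x)) (λ x → F x (suc K)))
        (cong (_+ ∑[ x ∈ xs ] F x (suc K)) (∑-sum1to-comm xs K F))

𝟙-≡ᵇ-≢ : ∀ {x y} → x ≢ y → 𝟙 (x ≡ᵇ y) ≡ 0
𝟙-≡ᵇ-≢ {x} {y} x≢y = cong 𝟙 (dec-false (x ≟ y) x≢y)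

sum1to-indicator-out : ∀ {K x} (G : ℕ → ℕ) → K < x → sum1to K (λ i → 𝟙 (x ≡ᵇ i) * G i) ≡ 0
sum1to-indicator-out {zero}  G _   = refl
sum1to-indicator-out {suc K} G K<x =
  cong₂ _+_ (sum1to-indicator-out G (<-trans (n<1+n K) K<x)) (cong (_* G (suc K)) (𝟙-≡ᵇ-≢ (>⇒≢ K<x)))

sum1to-indicator : ∀ {K x} (G : ℕ → ℕ) → 1 ≤ x → x ≤ K → sum1to K (λ i → 𝟙 (x ≡ᵇ i) * G i) ≡ G x
sum1to-indicator {zero}  {suc _} G _ ()
sum1to-indicator {suc K} {x} G 1≤x x≤1+K with m≤n⇒m<n∨m≡n x≤1+K
... | inj₁ x<1+K = trans
  (cong₂ _+_ (sum1to-indicator G 1≤x (s≤s⁻¹ x<1+K)) (cong (_* G (suc K)) (𝟙-≡ᵇ-≢ (<⇒≢ x<1+K))))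
  (+-identityʳ (G x))
... | inj₂ refl = trans
  (cong₂ _+_ (sum1to-indicator-out G (n<1+n K)) (cong (λ b → 𝟙 b * G (suc K)) (dec-true (suc K ≟ suc K) refl)))
  (+-identityʳ (G (suc K)))

𝟙-+≡ᵇ-as-sum1to : ∀ k X₁ X₂ Y → 1 ≤ X₁ → 1 ≤ X₂ →
  𝟙 ((X₁ + X₂ ≡ᵇ k) ∧ Y) ≡ sum1to (k ∸ 1) (λ i → 𝟙 (X₁ ≡ᵇ i) * 𝟙 ((X₂ ≡ᵇ k ∸ i) ∧ Y))
𝟙-+≡ᵇ-as-sum1to k X₁ X₂ Y 1≤X₁ 1≤X₂ with X₁ ≤? k ∸ 1
... | yes X₁≤k-1 = trans (cong (λ b → 𝟙 (b ∧ Y)) sum≡k⇔) (sym (sum1to-indicator _ 1≤X₁ X₁≤k-1))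
  where
  X₁≤k : X₁ ≤ k
  X₁≤k = ≤-trans X₁≤k-1 (m∸n≤m k 1)
  sum≡k⇔ : (X₁ + X₂ ≡ᵇ k) ≡ (X₂ ≡ᵇ k ∸ X₁)
  sum≡k⇔ = T-ext
    (λ h → ≡⇒≡ᵇ X₂ (k ∸ X₁) (trans (sym (m+n∸m≡n X₁ X₂)) (cong (_∸ X₁) (≡ᵇ⇒≡ _ _ h))))
    (λ h → ≡⇒≡ᵇ (X₁ + X₂) k (trans (cong (X₁ +_) (≡ᵇ⇒≡ _ _ h)) (m+[n∸m]≡n X₁≤k)))
... | no X₁≰k-1 = trans
  (cong (λ b → 𝟙 (b ∧ Y))
    (dec-false (X₁ + X₂ ≟ k) (λ sum≡k → X₁≰k-1 (<⇒≤∸1 (subst (X₁ <_) sum≡k (m<m+n X₁ 1≤X₂))))))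
  (sym (sum1to-indicator-out _ (≰⇒> X₁≰k-1)))

-- Enumerations and double counting

module _ (_≟_ : DecidableEquality A) where

  multiplicity : A → List A → ℕ
  multiplicity z xs = ∑[ x ∈ xs ] 𝟙 (does (x ≟ z))

  record Enumerates (xs : List A) : Set where
    field occurs-once : ∀ z → multiplicity z xs ≡ 1

open Enumerates

allFin-enumerates : ∀ n → Enumerates _≟ᶠ_ (allFin n)
allFin-enumerates n .occurs-once z = trans (∑-tabulate {n = n} id (λ i → 𝟙 (does (i ≟ᶠ z)))) (once z)
  where
  once : ∀ {n} (z : Fin n) → ∑[ i < n ] 𝟙 (does (i ≟ᶠ z)) ≡ 1
  once {suc n} zero    = cong suc (sumFin-zero n)
  once {suc n} (suc z) = once z

_≟ᵛ_ : ∀ {m n} → DecidableEquality (Vec (Fin n) m)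
_≟ᵛ_ = Vec.≡-dec _≟ᶠ_

allMaps-enumerates : ∀ m n → Enumerates _≟ᵛ_ (allMaps m n)
allMaps-enumerates zero    n .occurs-once []       = refl
allMaps-enumerates (suc m) n .occurs-once (z ∷ zs) = begin
  ∑[ w ∈ allMaps (suc m) n ] 𝟙 (does (w ≟ᵛ (z ∷ zs)))
    ≡⟨ ∑-concatMap _ (allMaps m n) _ ⟩
  ∑[ v ∈ allMaps m n ] ∑[ w ∈ map (_∷ v) (allFin n) ] 𝟙 (does (w ≟ᵛ (z ∷ zs)))
    ≡⟨ ∑-cong (allMaps m n) (λ v → ∑-map (_∷ v) (allFin n) _) ⟩
  ∑[ v ∈ allMaps m n ] ∑[ x ∈ allFin n ] 𝟙 (does (x ≟ᶠ z) ∧ does (v ≟ᵛ zs))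
    ≡⟨ ∑-cong (allMaps m n) (λ v → ∑-cong (allFin n) (λ x → 𝟙-∧ (does (x ≟ᶠ z)) _)) ⟩
  ∑[ v ∈ allMaps m n ] ∑[ x ∈ allFin n ] (𝟙 (does (x ≟ᶠ z)) * 𝟙 (does (v ≟ᵛ zs)))
    ≡⟨ ∑-cong (allMaps m n) (λ v → ∑-distribʳ-* (allFin n) _ _) ⟩
  ∑[ v ∈ allMaps m n ] (multiplicity _≟ᶠ_ z (allFin n) * 𝟙 (does (v ≟ᵛ zs)))
    ≡⟨ ∑-cong (allMaps m n) (λ v → trans (cong (_* _) (allFin-enumerates n .occurs-once z)) (*-identityˡ _)) ⟩
  ∑[ v ∈ allMaps m n ] 𝟙 (does (v ≟ᵛ zs))
    ≡⟨ allMaps-enumerates m n .occurs-once zs ⟩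
  1 ∎
  where open ≡-Reasoning

cartesianProduct-enumerates : ∀ {_≟A_ : DecidableEquality A} {_≟B_ : DecidableEquality B} {xs ys} →
  Enumerates _≟A_ xs → Enumerates _≟B_ ys → Enumerates (Product.≡-dec _≟A_ _≟B_) (cartesianProduct xs ys)
cartesianProduct-enumerates {_≟A_ = _≟A_} {_≟B_} {xs} {ys} enumXs enumYs .occurs-once (z₁ , z₂) = begin
  ∑[ w ∈ cartesianProduct xs ys ] 𝟙 (does (Product.≡-dec _≟A_ _≟B_ w (z₁ , z₂)))
    ≡⟨ ∑-cartesianProduct xs ys _ ⟩
  ∑[ x ∈ xs ] ∑[ y ∈ ys ] 𝟙 (does (Product.≡-dec _≟A_ _≟B_ (x , y) (z₁ , z₂)))
    ≡⟨ ∑-cong xs (λ x → ∑-cong ys (λ y → 𝟙-pair x y)) ⟩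
  ∑[ x ∈ xs ] ∑[ y ∈ ys ] (𝟙 (does (x ≟A z₁)) * 𝟙 (does (y ≟B z₂)))
    ≡⟨ ∑-product xs ys _ _ ⟩
  multiplicity _≟A_ z₁ xs * multiplicity _≟B_ z₂ ys
    ≡⟨ cong₂ _*_ (enumXs .occurs-once z₁) (enumYs .occurs-once z₂) ⟩
  1 ∎
  where
  open ≡-Reasoning
  𝟙-pair : ∀ x y → 𝟙 (does (Product.≡-dec _≟A_ _≟B_ (x , y) (z₁ , z₂))) ≡ 𝟙 (does (x ≟A z₁)) * 𝟙 (does (y ≟B z₂))
  𝟙-pair x y = trans
    (cong 𝟙 (does-⇔ (mk⇔ Product.,-injective Product.×-≡,≡→≡)
      (Product.≡-dec _≟A_ _≟B_ (x , y) (z₁ , z₂)) ((x ≟A z₁) ×-dec (y ≟B z₂))))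
    (𝟙-∧ (does (x ≟A z₁)) _)

record PartialBijection {A B : Set} (p : A → Bool) (q : B → Bool) : Set where
  field
    to       : A → B
    from     : B → A
    to-sat   : ∀ {x} → T (p x) → T (q (to x))
    from-sat : ∀ {y} → T (q y) → T (p (from y))
    from∘to  : ∀ {x} → T (p x) → from (to x) ≡ x
    to∘from  : ∀ {y} → T (q y) → to (from y) ≡ y

-- Double counting of the pairs (x , y) with q y and x = from y.
∑-𝟙-bijection : ∀ {_≟A_ : DecidableEquality A} {_≟B_ : DecidableEquality B} {xs ys p q} →
  PartialBijection p q → Enumerates _≟A_ xs → Enumerates _≟B_ ys →
  ∑[ x ∈ xs ] 𝟙 (p x) ≡ ∑[ y ∈ ys ] 𝟙 (q y)
∑-𝟙-bijection {A = A} {B = B} {_≟A_ = _≟A_} {_≟B_} {xs} {ys} {p} {q} f enumXs enumYs = begin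
  ∑[ x ∈ xs ] 𝟙 (p x)              ≡⟨ ∑-cong xs row ⟩
  ∑[ x ∈ xs ] ∑[ y ∈ ys ] hit x y  ≡⟨ ∑-comm xs ys hit ⟩
  ∑[ y ∈ ys ] ∑[ x ∈ xs ] hit x y  ≡⟨ ∑-cong ys column ⟩
  ∑[ y ∈ ys ] 𝟙 (q y)              ∎
  where
  open ≡-Reasoning
  open PartialBijection f
  hit : A → B → ℕ
  hit x y = 𝟙 (q y ∧ does (x ≟A from y))
  column : ∀ y → ∑[ x ∈ xs ] hit x y ≡ 𝟙 (q y)
  column y with q y
  ... | true  = enumXs .occurs-once (from y)
  ... | false = ∑-zero xs
  hit-sat : ∀ {x} → T (p x) → ∀ y → hit x y ≡ 𝟙 (does (y ≟B to x))
  hit-sat {x} px y with y ≟B to x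
  ... | yes refl  = 𝟙-∧-≡1 (to-sat px) (≡true⇒T (dec-true (x ≟A from (to x)) (sym (from∘to px))))
  ... | no y≢to-x = 𝟙-∧-≡0 (q y) λ qy x≡ → y≢to-x (trans (sym (to∘from qy)) (cong to (sym (T-does⇒ (x ≟A from y) x≡))))
  hit-unsat : ∀ {x} → ¬ T (p x) → ∀ y → hit x y ≡ 0
  hit-unsat {x} ¬px y = 𝟙-∧-≡0 (q y) λ qy x≡ → ¬px (subst (T ∘ p) (sym (T-does⇒ (x ≟A from y) x≡)) (from-sat qy))
  row : ∀ x → 𝟙 (p x) ≡ ∑[ y ∈ ys ] hit x y
  row x with p x in px
  ... | true  = sym (trans (∑-cong ys (hit-sat (≡true⇒T px))) (enumYs .occurs-once (to x)))
  ... | false = sym (trans (∑-cong ys (hit-unsat (subst T px))) (∑-zero ys))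

Endo : ℕ → Set
Endo n = Vec (Fin n) n

≗-lookup⇒≡ : ∀ {n} {xs ys : Vec A n} → (∀ i → lookup xs i ≡ lookup ys i) → xs ≡ ys
≗-lookup⇒≡ {xs = xs} {ys} eq = begin
  xs                     ≡⟨ Vec.tabulate∘lookup xs ⟨
  Vec.tabulate (lookup xs) ≡⟨ Vec.tabulate-cong eq ⟩
  Vec.tabulate (lookup ys) ≡⟨ Vec.tabulate∘lookup ys ⟩
  ys                     ∎
  where open ≡-Reasoning

and⁻ : ∀ bs → T (and bs) → All T bs
and⁻ []       _ = []
and⁻ (b ∷ bs) h = let tb , tbs = T-∧⁻ {b} h in tb ∷ and⁻ bs tbs

and⁺ : ∀ {bs} → All T bs → T (and bs)
and⁺ []         = _
and⁺ (tb ∷ tbs) = T-∧⁺ tb (and⁺ tbs)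

and-allFin⁻ : ∀ {n} (f : Fin n → Bool) → T (and (map f (allFin n))) → ∀ i → T (f i)
and-allFin⁻ f h = tabulate⁻ (map⁻ (and⁻ _ h))

and-allFin⁺ : ∀ {n} (f : Fin n → Bool) → (∀ i → T (f i)) → T (and (map f (allFin n)))
and-allFin⁺ f h = and⁺ (map⁺ (tabulate⁺ h))

module _ {n : ℕ} (σ : Endo n) where

  isPermᵇ-sound : T (isPermᵇ σ) → Injective _≡_ _≡_ (app σ)
  isPermᵇ-sound h {i} {j} σi≡σj = decide (tabulate⁻ (map⁻ (tabulate⁻ (map⁻ (concat⁻ (and⁻ _ h))) i)) j)
    where
    decide : T (if toℕ i ≡ᵇ toℕ j then true else not (toℕ (app σ i) ≡ᵇ toℕ (app σ j))) → i ≡ j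
    decide with toℕ i ≡ᵇ toℕ j in i≡ᵇj
    ... | true  = λ _ → toℕ-injective (T-does⇒ (toℕ i ≟ toℕ j) (≡true⇒T i≡ᵇj))
    ... | false = λ t → ⊥-elim (T-not-does⇒ (toℕ (app σ i) ≟ toℕ (app σ j)) t (cong toℕ σi≡σj))

  isPermᵇ-complete : Injective _≡_ _≡_ (app σ) → T (isPermᵇ σ)
  isPermᵇ-complete inj = and⁺ (concat⁺ (map⁺ (tabulate⁺ λ i → map⁺ (tabulate⁺ (entry i)))))
    where
    entry : ∀ i j → T (if toℕ i ≡ᵇ toℕ j then true else not (toℕ (app σ i) ≡ᵇ toℕ (app σ j)))
    entry i j with toℕ i ≡ᵇ toℕ j in i≡ᵇj
    ... | true  = _
    ... | false = ¬⇒T-not-does (toℕ (app σ i) ≟ toℕ (app σ j)) λ σi≡σj →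
      subst T i≡ᵇj (≡true⇒T (dec-true (toℕ i ≟ toℕ j) (cong toℕ (inj (toℕ-injective σi≡σj)))))

  IsDerangement : Set
  IsDerangement = ∀ i → app σ i ≢ i

  isDerangementᵇ-sound : T (isDerangementᵇ σ) → IsDerangement
  isDerangementᵇ-sound h i σi≡i = T-not-does⇒ (toℕ (app σ i) ≟ toℕ i) (and-allFin⁻ _ h i) (cong toℕ σi≡i)

  isDerangementᵇ-complete : IsDerangement → T (isDerangementᵇ σ)
  isDerangementᵇ-complete der = and-allFin⁺ _ λ i → ¬⇒T-not-does (toℕ (app σ i) ≟ toℕ i) (der i ∘ toℕ-injective)

  IsParityAlternating : Set
  IsParityAlternating = ∀ i → toℕ (app σ i) % 2 ≡ toℕ i % 2

  isPAPᵇ-sound : T (isPAPᵇ σ) → IsParityAlternating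
  isPAPᵇ-sound h i = T-does⇒ (toℕ (app σ i) % 2 ≟ toℕ i % 2) (and-allFin⁻ _ h i)

  isPAPᵇ-complete : IsParityAlternating → T (isPAPᵇ σ)
  isPAPᵇ-complete pap = and-allFin⁺ _ λ i → ≡true⇒T (dec-true (toℕ (app σ i) % 2 ≟ toℕ i % 2) (pap i))

  exc-as-sumFin : exc σ ≡ ∑[ i < n ] 𝟙 (toℕ i <ᵇ toℕ (app σ i))
  exc-as-sumFin = length-filterᵇ-allFin n _

  cycles-as-sumFin : cycles σ ≡ ∑[ i < n ] 𝟙 (isCycleMinᵇ σ i)
  cycles-as-sumFin = length-filterᵇ-allFin n _

  cycles≤n : cycles σ ≤ n
  cycles≤n = subst (_≤ n) (sym cycles-as-sumFin) (sumFin-𝟙≤ n _)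

  iter-+ : ∀ p q x → iter σ (p + q) x ≡ iter σ p (iter σ q x)
  iter-+ zero    q x = refl
  iter-+ (suc p) q x = cong (app σ) (iter-+ p q x)

  iter-suc′ : ∀ m x → iter σ (suc m) x ≡ iter σ m (app σ x)
  iter-suc′ zero    x = refl
  iter-suc′ (suc m) x = cong (app σ) (iter-suc′ m x)

  iter-*-fixed : ∀ {p x} → iter σ p x ≡ x → ∀ q → iter σ (q * p) x ≡ x
  iter-*-fixed         fixed zero    = refl
  iter-*-fixed {p} {x} fixed (suc q) = trans (iter-+ p (q * p) x) (trans (cong (iter σ p) (iter-*-fixed fixed q)) fixed)

  iter-%-period : ∀ {r x} → iter σ (suc r) x ≡ x → ∀ m → iter σ m x ≡ iter σ (m % suc r) x
  iter-%-period {r} {x} fixed m = begin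
    iter σ m x                                          ≡⟨ cong (λ t → iter σ t x) (m≡m%n+[m/n]*n m (suc r)) ⟩
    iter σ (m % suc r + (m / suc r) * suc r) x          ≡⟨ iter-+ (m % suc r) _ x ⟩
    iter σ (m % suc r) (iter σ ((m / suc r) * suc r) x) ≡⟨ cong (iter σ (m % suc r)) (iter-*-fixed fixed (m / suc r)) ⟩
    iter σ (m % suc r) x                                ∎
    where open ≡-Reasoning

  module _ (inj : Injective _≡_ _≡_ (app σ)) where

    iter-injective : ∀ p {x y} → iter σ p x ≡ iter σ p y → x ≡ y
    iter-injective zero    eq = eq
    iter-injective (suc p) eq = iter-injective p (inj eq)

    -- By pigeonhole two of σ⁰(i), …, σⁿ(i) coincide.
    period : ∀ i → ∃[ r ] r < n × iter σ (suc r) i ≡ i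
    period i with pigeonhole (n<1+n n) (λ u → iter σ (toℕ u) i)
    ... | u , v , u<v , same = r , r<n , iter-injective (toℕ u) (begin
      iter σ (toℕ u) (iter σ (suc r) i) ≡⟨ iter-+ (toℕ u) (suc r) i ⟨
      iter σ (toℕ u + suc r) i          ≡⟨ cong (λ t → iter σ t i) u+1+r≡v ⟩
      iter σ (toℕ v) i                  ≡⟨ same ⟨
      iter σ (toℕ u) i                  ∎)
      where
      open ≡-Reasoning
      r : ℕ
      r = toℕ v ∸ suc (toℕ u)
      u+1+r≡v : toℕ u + suc r ≡ toℕ v
      u+1+r≡v = trans (+-suc (toℕ u) r) (m+[n∸m]≡n u<v)
      r<n : r < n
      r<n = <-≤-trans (subst (r <_) u+1+r≡v (m≤n+m (suc r) (toℕ u))) (s≤s⁻¹ (toℕ<n v))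

    -- Defs only tests σ¹(i), …, σⁿ(i); the period of i reduces every other power to these.
    isCycleMinᵇ-sound : ∀ {i} → T (isCycleMinᵇ σ i) → ∀ m → toℕ i ≤ toℕ (iter σ m i)
    isCycleMinᵇ-sound {i} h m with period i
    ... | r , r<n , fixed = subst (λ x → toℕ i ≤ toℕ x) (sym (iter-%-period fixed m)) (bound (m % suc r) (m%n<n m (suc r)))
      where
      bound : ∀ t → t < suc r → toℕ i ≤ toℕ (iter σ t i)
      bound zero    _     = ≤-refl
      bound (suc t) t<r = subst (λ s → toℕ i ≤ toℕ (iter σ (suc s) i)) (toℕ-fromℕ< t<n)
                                (≤ᵇ⇒≤ _ _ (and-allFin⁻ _ h (fromℕ< t<n)))
        where
        t<n : t < n
        t<n = <-trans (s≤s⁻¹ t<r) r<n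

  isCycleMinᵇ-complete : ∀ {i} → (∀ m → toℕ i ≤ toℕ (iter σ m i)) → T (isCycleMinᵇ σ i)
  isCycleMinᵇ-complete h = and-allFin⁺ {n} _ λ j → ≤⇒≤ᵇ (h (suc (toℕ j)))

derangementWith : ∀ {m} → ℕ → Bool → Endo m → Bool
derangementWith i e τ = isPermᵇ τ ∧ isDerangementᵇ τ ∧ (exc τ ≡ᵇ i) ∧ xnor (isEvenᵇ τ) e

papWith : ∀ {n} → ℕ → Bool → Endo n → Bool
papWith k e σ = isPermᵇ σ ∧ isPAPᵇ σ ∧ isDerangementᵇ σ ∧ (exc σ ≡ᵇ k) ∧ xnor (isEvenᵇ σ) e

-- Positions are 0-indexed: evenᶠ lists the paper's odd positions 1, 3, 5, …, and oddᶠ its even ones.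
evenᶠ : ∀ {n} → Fin ⌈ n /2⌉ → Fin n
evenᶠ {suc n}       zero    = zero
evenᶠ {suc (suc n)} (suc j) = suc (suc (evenᶠ j))

oddᶠ : ∀ {n} → Fin ⌊ n /2⌋ → Fin n
oddᶠ {suc (suc n)} zero    = suc zero
oddᶠ {suc (suc n)} (suc j) = suc (suc (oddᶠ j))

halve : ∀ {n} → Fin n → Fin ⌈ n /2⌉ ⊎ Fin ⌊ n /2⌋
halve {suc n}       zero          = inj₁ zero
halve {suc (suc n)} (suc zero)    = inj₂ zero
halve {suc (suc n)} (suc (suc x)) = Sum.map suc suc (halve x)

halve-evenᶠ : ∀ {n} (j : Fin ⌈ n /2⌉) → halve {n} (evenᶠ j) ≡ inj₁ j
halve-evenᶠ {suc n}       zero    = refl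
halve-evenᶠ {suc (suc n)} (suc j) = cong (Sum.map Fin.suc Fin.suc) (halve-evenᶠ {n} j)

halve-oddᶠ : ∀ {n} (j : Fin ⌊ n /2⌋) → halve {n} (oddᶠ j) ≡ inj₂ j
halve-oddᶠ {suc (suc n)} zero    = refl
halve-oddᶠ {suc (suc n)} (suc j) = cong (Sum.map Fin.suc Fin.suc) (halve-oddᶠ {n} j)

halve⁻¹ : ∀ {n} (x : Fin n) → [ evenᶠ , oddᶠ ] (halve x) ≡ x
halve⁻¹ {suc n}       zero          = refl
halve⁻¹ {suc (suc n)} (suc zero)    = refl
halve⁻¹ {suc (suc n)} (suc (suc x)) with halve x | halve⁻¹ x
... | inj₁ j | evenᶠj≡x = cong (Fin.suc ∘ Fin.suc) evenᶠj≡x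
... | inj₂ j | oddᶠj≡x  = cong (Fin.suc ∘ Fin.suc) oddᶠj≡x

evenᶠ-or-oddᶠ : ∀ {n} (x : Fin n) → (∃[ j ] evenᶠ j ≡ x) ⊎ (∃[ j ] oddᶠ j ≡ x)
evenᶠ-or-oddᶠ x with halve x | halve⁻¹ x
... | inj₁ j | evenᶠj≡x = inj₁ (j , evenᶠj≡x)
... | inj₂ j | oddᶠj≡x  = inj₂ (j , oddᶠj≡x)

evenᶠ-injective : ∀ {n} → Injective _≡_ _≡_ (evenᶠ {n})
evenᶠ-injective {n} {i} {j} eq = inj₁-injective (trans (sym (halve-evenᶠ {n} i)) (trans (cong halve eq) (halve-evenᶠ {n} j)))

oddᶠ-injective : ∀ {n} → Injective _≡_ _≡_ (oddᶠ {n})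
oddᶠ-injective {n} {i} {j} eq = inj₂-injective (trans (sym (halve-oddᶠ {n} i)) (trans (cong halve eq) (halve-oddᶠ {n} j)))

evenᶠ≢oddᶠ : ∀ {n} (i : Fin ⌈ n /2⌉) (j : Fin ⌊ n /2⌋) → evenᶠ i ≢ oddᶠ j
evenᶠ≢oddᶠ {n} i j eq with trans (sym (halve-evenᶠ {n} i)) (trans (cong halve eq) (halve-oddᶠ {n} j))
... | ()

toℕ-evenᶠ : ∀ {n} (j : Fin ⌈ n /2⌉) → toℕ (evenᶠ {n} j) ≡ 2 * toℕ j
toℕ-evenᶠ {suc n}       zero    = refl
toℕ-evenᶠ {suc (suc n)} (suc j) = trans (cong (2 +_) (toℕ-evenᶠ {n} j)) (sym (*-suc 2 (toℕ j)))

toℕ-oddᶠ : ∀ {n} (j : Fin ⌊ n /2⌋) → toℕ (oddᶠ {n} j) ≡ suc (2 * toℕ j)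
toℕ-oddᶠ {suc (suc n)} zero    = refl
toℕ-oddᶠ {suc (suc n)} (suc j) = trans (cong (2 +_) (toℕ-oddᶠ {n} j)) (cong (1 +_) (sym (*-suc 2 (toℕ j))))

sumFin-halve : ∀ n (F : Fin n → ℕ) → sumFin n F ≡ ∑[ j < ⌈ n /2⌉ ] F (evenᶠ j) + ∑[ j < ⌊ n /2⌋ ] F (oddᶠ j)
sumFin-halve zero          F = refl
sumFin-halve (suc zero)    F = sym (+-identityʳ _)
sumFin-halve (suc (suc n)) F = begin
  F zero + (F (suc zero) + sumFin n (F ∘ Fin.suc ∘ Fin.suc))
    ≡⟨ cong (λ t → F zero + (F (suc zero) + t)) (sumFin-halve n (F ∘ Fin.suc ∘ Fin.suc)) ⟩
  F zero + (F (suc zero) + (evens + odds))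
    ≡⟨ cong (F zero +_) (x∙yz≈y∙xz (F (suc zero)) evens odds) ⟩
  F zero + (evens + (F (suc zero) + odds))
    ≡⟨ +-assoc (F zero) evens _ ⟨
  F zero + evens + (F (suc zero) + odds) ∎
  where
  open ≡-Reasoning
  evens = ∑[ j < ⌈ n /2⌉ ] F (suc (suc (evenᶠ j)))
  odds  = ∑[ j < ⌊ n /2⌋ ] F (suc (suc (oddᶠ j)))

evenᶠ-%2 : ∀ {n} (j : Fin ⌈ n /2⌉) → toℕ (evenᶠ {n} j) % 2 ≡ 0
evenᶠ-%2 {n} j = trans (cong (_% 2) (trans (toℕ-evenᶠ {n} j) (*-comm 2 (toℕ j)))) (m*n%n≡0 (toℕ j) 2)

oddᶠ-%2 : ∀ {n} (j : Fin ⌊ n /2⌋) → toℕ (oddᶠ {n} j) % 2 ≡ 1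
oddᶠ-%2 {n} j = trans (cong (_% 2) (trans (toℕ-oddᶠ {n} j) (cong suc (*-comm 2 (toℕ j))))) ([m+kn]%n≡m%n 1 (toℕ j) 2)

evenᶠ-<ᵇ : ∀ {n} (i j : Fin ⌈ n /2⌉) → (toℕ (evenᶠ {n} i) <ᵇ toℕ (evenᶠ {n} j)) ≡ (toℕ i <ᵇ toℕ j)
evenᶠ-<ᵇ {n} i j rewrite toℕ-evenᶠ {n} i | toℕ-evenᶠ {n} j = T-ext
  (λ h → <⇒<ᵇ (*-cancelˡ-< 2 (toℕ i) (toℕ j) (<ᵇ⇒< (2 * toℕ i) (2 * toℕ j) h)))
  (λ h → <⇒<ᵇ (*-monoʳ-< 2 (<ᵇ⇒< (toℕ i) (toℕ j) h)))

oddᶠ-<ᵇ : ∀ {n} (i j : Fin ⌊ n /2⌋) → (toℕ (oddᶠ {n} i) <ᵇ toℕ (oddᶠ {n} j)) ≡ (toℕ i <ᵇ toℕ j)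
oddᶠ-<ᵇ {n} i j rewrite toℕ-oddᶠ {n} i | toℕ-oddᶠ {n} j = T-ext
  (λ h → <⇒<ᵇ (*-cancelˡ-< 2 (toℕ i) (toℕ j) (<ᵇ⇒< (2 * toℕ i) (2 * toℕ j) h)))
  (λ h → <⇒<ᵇ (*-monoʳ-< 2 (<ᵇ⇒< (toℕ i) (toℕ j) h)))

evenᶠ-≤⇔ : ∀ {n} {i j : Fin ⌈ n /2⌉} → toℕ (evenᶠ {n} i) ≤ toℕ (evenᶠ {n} j) ⇔ toℕ i ≤ toℕ j
evenᶠ-≤⇔ {n} {i} {j} rewrite toℕ-evenᶠ {n} i | toℕ-evenᶠ {n} j = mk⇔ (*-cancelˡ-≤ 2) (*-monoʳ-≤ 2)

oddᶠ-≤⇔ : ∀ {n} {i j : Fin ⌊ n /2⌋} → toℕ (oddᶠ {n} i) ≤ toℕ (oddᶠ {n} j) ⇔ toℕ i ≤ toℕ j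
oddᶠ-≤⇔ {n} {i} {j} rewrite toℕ-oddᶠ {n} i | toℕ-oddᶠ {n} j = mk⇔ (*-cancelˡ-≤ 2 ∘ s≤s⁻¹) (s≤s ∘ *-monoʳ-≤ 2)

-- Parity alternating permutations as interleavings

record IsInterleaving {n} (σ : Endo n) (τ₁ : Endo ⌈ n /2⌉) (τ₂ : Endo ⌊ n /2⌋) : Set where
  field
    on-evenᶠ : ∀ j → app σ (evenᶠ j) ≡ evenᶠ (app τ₁ j)
    on-oddᶠ  : ∀ j → app σ (oddᶠ j) ≡ oddᶠ (app τ₂ j)

module Interleaving {n} {σ : Endo n} {τ₁ : Endo ⌈ n /2⌉} {τ₂ : Endo ⌊ n /2⌋} (σ≋τ : IsInterleaving σ τ₁ τ₂) where
  open IsInterleaving σ≋τ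

  injective⁻ : Injective _≡_ _≡_ (app σ) → Injective _≡_ _≡_ (app τ₁) × Injective _≡_ _≡_ (app τ₂)
  injective⁻ inj = (λ {i} {j} eq → evenᶠ-injective {n} (inj (trans (on-evenᶠ i) (trans (cong evenᶠ eq) (sym (on-evenᶠ j))))))
                 , (λ {i} {j} eq → oddᶠ-injective {n} (inj (trans (on-oddᶠ i) (trans (cong oddᶠ eq) (sym (on-oddᶠ j))))))

  injective⁺ : Injective _≡_ _≡_ (app τ₁) → Injective _≡_ _≡_ (app τ₂) → Injective _≡_ _≡_ (app σ)
  injective⁺ inj-τ₁ inj-τ₂ {x} {y} eq with evenᶠ-or-oddᶠ x | evenᶠ-or-oddᶠ y
  ... | inj₁ (i , refl) | inj₁ (j , refl) =
    cong evenᶠ (inj-τ₁ (evenᶠ-injective {n} (trans (sym (on-evenᶠ i)) (trans eq (on-evenᶠ j)))))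
  ... | inj₁ (i , refl) | inj₂ (j , refl) = ⊥-elim (evenᶠ≢oddᶠ _ _ (trans (sym (on-evenᶠ i)) (trans eq (on-oddᶠ j))))
  ... | inj₂ (i , refl) | inj₁ (j , refl) = ⊥-elim (evenᶠ≢oddᶠ _ _ (trans (sym (on-evenᶠ j)) (trans (sym eq) (on-oddᶠ i))))
  ... | inj₂ (i , refl) | inj₂ (j , refl) =
    cong oddᶠ (inj-τ₂ (oddᶠ-injective {n} (trans (sym (on-oddᶠ i)) (trans eq (on-oddᶠ j)))))

  isPermᵇ-≡ : isPermᵇ σ ≡ isPermᵇ τ₁ ∧ isPermᵇ τ₂
  isPermᵇ-≡ = T-ext
    (λ h → let inj-τ₁ , inj-τ₂ = injective⁻ (isPermᵇ-sound σ h)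
           in T-∧⁺ (isPermᵇ-complete τ₁ inj-τ₁) (isPermᵇ-complete τ₂ inj-τ₂))
    (λ h → let p₁ , p₂ = T-∧⁻ {isPermᵇ τ₁} h
           in isPermᵇ-complete σ (injective⁺ (isPermᵇ-sound τ₁ p₁) (isPermᵇ-sound τ₂ p₂)))

  isParityAlternating : IsParityAlternating σ
  isParityAlternating x with evenᶠ-or-oddᶠ x
  ... | inj₁ (j , refl) = trans (cong (λ y → toℕ y % 2) (on-evenᶠ j)) (trans (evenᶠ-%2 {n} _) (sym (evenᶠ-%2 {n} j)))
  ... | inj₂ (j , refl) = trans (cong (λ y → toℕ y % 2) (on-oddᶠ j)) (trans (oddᶠ-%2 {n} _) (sym (oddᶠ-%2 {n} j)))

  isDerangementᵇ-≡ : isDerangementᵇ σ ≡ isDerangementᵇ τ₁ ∧ isDerangementᵇ τ₂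
  isDerangementᵇ-≡ = T-ext
    (λ h → let der = isDerangementᵇ-sound σ h in T-∧⁺
      (isDerangementᵇ-complete τ₁ (λ j eq → der (evenᶠ j) (trans (on-evenᶠ j) (cong evenᶠ eq))))
      (isDerangementᵇ-complete τ₂ (λ j eq → der (oddᶠ j) (trans (on-oddᶠ j) (cong oddᶠ eq)))))
    (λ h → let d₁ , d₂ = T-∧⁻ {isDerangementᵇ τ₁} h
           in isDerangementᵇ-complete σ (der (isDerangementᵇ-sound τ₁ d₁) (isDerangementᵇ-sound τ₂ d₂)))
    where
    der : IsDerangement τ₁ → IsDerangement τ₂ → IsDerangement σ
    der der₁ der₂ x eq with evenᶠ-or-oddᶠ x
    ... | inj₁ (j , refl) = der₁ j (evenᶠ-injective {n} (trans (sym (on-evenᶠ j)) eq))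
    ... | inj₂ (j , refl) = der₂ j (oddᶠ-injective {n} (trans (sym (on-oddᶠ j)) eq))

  exc-≡ : exc σ ≡ exc τ₁ + exc τ₂
  exc-≡ = begin
    exc σ
      ≡⟨ exc-as-sumFin σ ⟩
    ∑[ x < n ] 𝟙 (toℕ x <ᵇ toℕ (app σ x))
      ≡⟨ sumFin-halve n _ ⟩
    ∑[ j < ⌈ n /2⌉ ] 𝟙 (toℕ (evenᶠ j) <ᵇ toℕ (app σ (evenᶠ j)))
      + ∑[ j < ⌊ n /2⌋ ] 𝟙 (toℕ (oddᶠ j) <ᵇ toℕ (app σ (oddᶠ j)))
      ≡⟨ cong₂ _+_ (sumFin-cong ⌈ n /2⌉ excedance-evenᶠ) (sumFin-cong ⌊ n /2⌋ excedance-oddᶠ) ⟩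
    ∑[ j < ⌈ n /2⌉ ] 𝟙 (toℕ j <ᵇ toℕ (app τ₁ j)) + ∑[ j < ⌊ n /2⌋ ] 𝟙 (toℕ j <ᵇ toℕ (app τ₂ j))
      ≡⟨ cong₂ _+_ (exc-as-sumFin τ₁) (exc-as-sumFin τ₂) ⟨
    exc τ₁ + exc τ₂ ∎
    where
    open ≡-Reasoning
    excedance-evenᶠ : ∀ j → 𝟙 (toℕ (evenᶠ j) <ᵇ toℕ (app σ (evenᶠ j))) ≡ 𝟙 (toℕ j <ᵇ toℕ (app τ₁ j))
    excedance-evenᶠ j = cong 𝟙 (trans (cong (λ y → toℕ (evenᶠ j) <ᵇ toℕ y) (on-evenᶠ j)) (evenᶠ-<ᵇ {n} j _))
    excedance-oddᶠ : ∀ j → 𝟙 (toℕ (oddᶠ j) <ᵇ toℕ (app σ (oddᶠ j))) ≡ 𝟙 (toℕ j <ᵇ toℕ (app τ₂ j))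
    excedance-oddᶠ j = cong 𝟙 (trans (cong (λ y → toℕ (oddᶠ j) <ᵇ toℕ y) (on-oddᶠ j)) (oddᶠ-<ᵇ {n} j _))

  iter-evenᶠ : ∀ m j → iter σ m (evenᶠ j) ≡ evenᶠ (iter τ₁ m j)
  iter-evenᶠ zero    j = refl
  iter-evenᶠ (suc m) j = trans (cong (app σ) (iter-evenᶠ m j)) (on-evenᶠ _)

  iter-oddᶠ : ∀ m j → iter σ m (oddᶠ j) ≡ oddᶠ (iter τ₂ m j)
  iter-oddᶠ zero    j = refl
  iter-oddᶠ (suc m) j = trans (cong (app σ) (iter-oddᶠ m j)) (on-oddᶠ _)

  module _ (inj : Injective _≡_ _≡_ (app σ)) where

    isCycleMinᵇ-evenᶠ : ∀ j → isCycleMinᵇ σ (evenᶠ j) ≡ isCycleMinᵇ τ₁ j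
    isCycleMinᵇ-evenᶠ j = T-ext
      (λ h → isCycleMinᵇ-complete τ₁ λ m → Equivalence.to (evenᶠ-≤⇔ {n})
        (subst (λ y → toℕ (evenᶠ j) ≤ toℕ y) (iter-evenᶠ m j) (isCycleMinᵇ-sound σ inj h m)))
      (λ h → isCycleMinᵇ-complete σ λ m → subst (λ y → toℕ (evenᶠ j) ≤ toℕ y) (sym (iter-evenᶠ m j))
        (Equivalence.from (evenᶠ-≤⇔ {n}) (isCycleMinᵇ-sound τ₁ (proj₁ (injective⁻ inj)) h m)))

    isCycleMinᵇ-oddᶠ : ∀ j → isCycleMinᵇ σ (oddᶠ j) ≡ isCycleMinᵇ τ₂ j
    isCycleMinᵇ-oddᶠ j = T-ext
      (λ h → isCycleMinᵇ-complete τ₂ λ m → Equivalence.to (oddᶠ-≤⇔ {n})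
        (subst (λ y → toℕ (oddᶠ j) ≤ toℕ y) (iter-oddᶠ m j) (isCycleMinᵇ-sound σ inj h m)))
      (λ h → isCycleMinᵇ-complete σ λ m → subst (λ y → toℕ (oddᶠ j) ≤ toℕ y) (sym (iter-oddᶠ m j))
        (Equivalence.from (oddᶠ-≤⇔ {n}) (isCycleMinᵇ-sound τ₂ (proj₂ (injective⁻ inj)) h m)))

    cycles-≡ : cycles σ ≡ cycles τ₁ + cycles τ₂
    cycles-≡ = trans (cycles-as-sumFin σ) (trans (sumFin-halve n _) (cong₂ _+_
      (trans (sumFin-cong ⌈ n /2⌉ (cong 𝟙 ∘ isCycleMinᵇ-evenᶠ)) (sym (cycles-as-sumFin τ₁)))
      (trans (sumFin-cong ⌊ n /2⌋ (cong 𝟙 ∘ isCycleMinᵇ-oddᶠ)) (sym (cycles-as-sumFin τ₂)))))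

    isEvenᵇ-≡ : isEvenᵇ σ ≡ xnor (isEvenᵇ τ₁) (isEvenᵇ τ₂)
    isEvenᵇ-≡ = trans (cong (λ t → t % 2 ≡ᵇ 0) n∸c≡) (even%-+ (⌈ n /2⌉ ∸ cycles τ₁) (⌊ n /2⌋ ∸ cycles τ₂))
      where
      n∸c≡ : n ∸ cycles σ ≡ (⌈ n /2⌉ ∸ cycles τ₁) + (⌊ n /2⌋ ∸ cycles τ₂)
      n∸c≡ = trans (cong₂ _∸_ (trans (sym (⌊n/2⌋+⌈n/2⌉≡n n)) (+-comm ⌊ n /2⌋ ⌈ n /2⌉)) cycles-≡)
                   ([m+n]∸[o+p]≡[m∸o]+[n∸p] (cycles≤n τ₁) (cycles≤n τ₂))

  papWith-≡ : ∀ k e → papWith k e σ ≡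
    (isPermᵇ τ₁ ∧ isPermᵇ τ₂) ∧ (isDerangementᵇ τ₁ ∧ isDerangementᵇ τ₂)
      ∧ (exc τ₁ + exc τ₂ ≡ᵇ k) ∧ xnor (xnor (isEvenᵇ τ₁) (isEvenᵇ τ₂)) e
  papWith-≡ k e = trans (cong (_∧ _) isPermᵇ-≡) (∧-congˡ-T (isPermᵇ τ₁ ∧ isPermᵇ τ₂) λ perms →
    cong₂ _∧_ (T⇒≡true (isPAPᵇ-complete σ isParityAlternating))
      (cong₂ _∧_ isDerangementᵇ-≡ (cong₂ _∧_ (cong (_≡ᵇ k) exc-≡)
        (cong (λ E → xnor E e) (isEvenᵇ-≡
          (injective⁺ (isPermᵇ-sound τ₁ (proj₁ (T-∧⁻ perms))) (isPermᵇ-sound τ₂ (proj₂ (T-∧⁻ perms)))))))))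

interleave : ∀ {n} → Endo ⌈ n /2⌉ → Endo ⌊ n /2⌋ → Endo n
interleave τ₁ τ₂ = Vec.tabulate (Sum.[ evenᶠ ∘ app τ₁ , oddᶠ ∘ app τ₂ ]′ ∘ halve)

-- Off parity-alternating σ the fallback values are junk.
deinterleave : ∀ {n} → Endo n → Endo ⌈ n /2⌉ × Endo ⌊ n /2⌋
deinterleave σ = Vec.tabulate (λ j → fromInj₁ (λ _ → j) (halve (app σ (evenᶠ j))))
               , Vec.tabulate (λ j → fromInj₂ (λ _ → j) (halve (app σ (oddᶠ j))))

interleave-isInterleaving : ∀ {n} (τ₁ : Endo ⌈ n /2⌉) (τ₂ : Endo ⌊ n /2⌋) → IsInterleaving (interleave τ₁ τ₂) τ₁ τ₂
interleave-isInterleaving {n} τ₁ τ₂ = record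
  { on-evenᶠ = λ j → trans (Vec.lookup∘tabulate _ (evenᶠ j)) (cong merge (halve-evenᶠ {n} j))
  ; on-oddᶠ  = λ j → trans (Vec.lookup∘tabulate _ (oddᶠ j)) (cong merge (halve-oddᶠ {n} j))
  }
  where
  merge : Fin ⌈ n /2⌉ ⊎ Fin ⌊ n /2⌋ → Fin n
  merge = Sum.[ evenᶠ ∘ app τ₁ , oddᶠ ∘ app τ₂ ]′

deinterleave-isInterleaving : ∀ {n} (σ : Endo n) → IsParityAlternating σ →
  IsInterleaving σ (proj₁ (deinterleave σ)) (proj₂ (deinterleave σ))
deinterleave-isInterleaving {n} σ pap = record
  { on-evenᶠ = λ j → trans (onEven j (halve (app σ (evenᶠ j))) (halve⁻¹ _)) (cong evenᶠ (sym (Vec.lookup∘tabulate _ j)))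
  ; on-oddᶠ  = λ j → trans (onOdd j (halve (app σ (oddᶠ j))) (halve⁻¹ _)) (cong oddᶠ (sym (Vec.lookup∘tabulate _ j)))
  }
  where
  onEven : ∀ j s → Sum.[ evenᶠ , oddᶠ ]′ s ≡ app σ (evenᶠ j) → app σ (evenᶠ j) ≡ evenᶠ (fromInj₁ (λ _ → j) s)
  onEven j (inj₁ y) eq = sym eq
  onEven j (inj₂ y) eq with trans (sym (oddᶠ-%2 {n} y)) (trans (cong (λ x → toℕ x % 2) eq) (trans (pap (evenᶠ j)) (evenᶠ-%2 {n} j)))
  ... | ()
  onOdd : ∀ j s → Sum.[ evenᶠ , oddᶠ ]′ s ≡ app σ (oddᶠ j) → app σ (oddᶠ j) ≡ oddᶠ (fromInj₂ (λ _ → j) s)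
  onOdd j (inj₂ y) eq = sym eq
  onOdd j (inj₁ y) eq with trans (sym (evenᶠ-%2 {n} y)) (trans (cong (λ x → toℕ x % 2) eq) (trans (pap (oddᶠ j)) (oddᶠ-%2 {n} j)))
  ... | ()

isInterleaving-unique-σ : ∀ {n} {σ σ′ : Endo n} {τ₁ τ₂} →
  IsInterleaving σ τ₁ τ₂ → IsInterleaving σ′ τ₁ τ₂ → σ ≡ σ′
isInterleaving-unique-σ {σ = σ} {σ′} σ≋τ σ′≋τ = ≗-lookup⇒≡ agree
  where
  open IsInterleaving
  agree : ∀ x → app σ x ≡ app σ′ x
  agree x with evenᶠ-or-oddᶠ x
  ... | inj₁ (j , refl) = trans (on-evenᶠ σ≋τ j) (sym (on-evenᶠ σ′≋τ j))
  ... | inj₂ (j , refl) = trans (on-oddᶠ σ≋τ j) (sym (on-oddᶠ σ′≋τ j))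

isInterleaving-unique-τ : ∀ {n} {σ : Endo n} {τ₁ τ₁′ τ₂ τ₂′} →
  IsInterleaving σ τ₁ τ₂ → IsInterleaving σ τ₁′ τ₂′ → (τ₁ , τ₂) ≡ (τ₁′ , τ₂′)
isInterleaving-unique-τ {n} σ≋τ σ≋τ′ = cong₂ _,_
  (≗-lookup⇒≡ λ j → evenᶠ-injective {n} (trans (sym (on-evenᶠ σ≋τ j)) (on-evenᶠ σ≋τ′ j)))
  (≗-lookup⇒≡ λ j → oddᶠ-injective {n} (trans (sym (on-oddᶠ σ≋τ j)) (on-oddᶠ σ≋τ′ j)))
  where open IsInterleaving

interleave∘deinterleave : ∀ {n} (σ : Endo n) → IsParityAlternating σ → uncurry interleave (deinterleave σ) ≡ σ
interleave∘deinterleave σ pap = isInterleaving-unique-σ (interleave-isInterleaving _ _) (deinterleave-isInterleaving σ pap)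

deinterleave∘interleave : ∀ {n} (τ₁ : Endo ⌈ n /2⌉) (τ₂ : Endo ⌊ n /2⌋) → deinterleave (interleave τ₁ τ₂) ≡ (τ₁ , τ₂)
deinterleave∘interleave τ₁ τ₂ = isInterleaving-unique-τ
  (deinterleave-isInterleaving _ (Interleaving.isParityAlternating (interleave-isInterleaving τ₁ τ₂)))
  (interleave-isInterleaving τ₁ τ₂)

-- Inverse permutations

iter-leftInverse : ∀ {n} {σ ρ : Endo n} → (∀ y → app ρ (app σ y) ≡ y) → ∀ m x → iter ρ m (iter σ m x) ≡ x
iter-leftInverse             ρσ≡id zero    x = refl
iter-leftInverse {σ = σ} {ρ} ρσ≡id (suc m) x = begin
  app ρ (iter ρ m (iter σ (suc m) x))  ≡⟨ cong (app ρ ∘ iter ρ m) (iter-suc′ σ m x) ⟩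
  app ρ (iter ρ m (iter σ m (app σ x))) ≡⟨ cong (app ρ) (iter-leftInverse ρσ≡id m (app σ x)) ⟩
  app ρ (app σ x)                       ≡⟨ ρσ≡id x ⟩
  x                                     ∎
  where open ≡-Reasoning

-- ρᵐ(i) = σ^(m·r)(i) when σ^(r+1)(i) = i.
leftInverse-orbit : ∀ {n} {σ ρ : Endo n} → Injective _≡_ _≡_ (app σ) → (∀ y → app ρ (app σ y) ≡ y) →
  ∀ i m → ∃[ t ] iter ρ m i ≡ iter σ t i
leftInverse-orbit {σ = σ} {ρ} inj ρσ≡id i m with period σ inj i
... | r , _ , fixed = m * r , (begin
  iter ρ m i                                ≡⟨ cong (iter ρ m) (iter-*-fixed σ fixed m) ⟨
  iter ρ m (iter σ (m * suc r) i)           ≡⟨ cong (λ t → iter ρ m (iter σ t i)) (*-suc m r) ⟩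
  iter ρ m (iter σ (m + m * r) i)           ≡⟨ cong (iter ρ m) (iter-+ σ m (m * r) i) ⟩
  iter ρ m (iter σ m (iter σ (m * r) i))    ≡⟨ iter-leftInverse ρσ≡id m _ ⟩
  iter σ (m * r) i                          ∎)
  where open ≡-Reasoning

preimage : ∀ {n} → Endo n → Fin n → Fin n
preimage σ x with any? (λ y → app σ y ≟ᶠ x)
... | yes (y , _) = y
... | no _        = x

inverse : ∀ {n} → Endo n → Endo n
inverse σ = Vec.tabulate (preimage σ)

module Inverse {n} (σ : Endo n) (inj : Injective _≡_ _≡_ (app σ)) where

  inverseʳ : ∀ x → app σ (app (inverse σ) x) ≡ x
  inverseʳ x = trans (cong (app σ) (Vec.lookup∘tabulate (preimage σ) x)) (app-preimage x)
    where
    app-preimage : ∀ x → app σ (preimage σ x) ≡ x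
    app-preimage x with any? (λ y → app σ y ≟ᶠ x)
    ... | yes (y , σy≡x) = σy≡x
    ... | no ∄y with period σ inj x
    ...   | r , _ , fixed = ⊥-elim (∄y (iter σ r x , fixed))

  inverseˡ : ∀ y → app (inverse σ) (app σ y) ≡ y
  inverseˡ y = inj (inverseʳ (app σ y))

  inverse-injective : Injective _≡_ _≡_ (app (inverse σ))
  inverse-injective {x} {x′} eq = trans (sym (inverseʳ x)) (trans (cong (app σ) eq) (inverseʳ x′))

  isCycleMinᵇ-inverse : ∀ i → isCycleMinᵇ (inverse σ) i ≡ isCycleMinᵇ σ i
  isCycleMinᵇ-inverse i = T-ext
    (λ h → isCycleMinᵇ-complete σ λ m → let t , eq = leftInverse-orbit inverse-injective inverseʳ i m in
      subst (λ x → toℕ i ≤ toℕ x) (sym eq) (isCycleMinᵇ-sound (inverse σ) inverse-injective h t))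
    (λ h → isCycleMinᵇ-complete (inverse σ) λ m → let t , eq = leftInverse-orbit inj inverseˡ i m in
      subst (λ x → toℕ i ≤ toℕ x) (sym eq) (isCycleMinᵇ-sound σ inj h t))

  isEvenᵇ-inverse : isEvenᵇ (inverse σ) ≡ isEvenᵇ σ
  isEvenᵇ-inverse = cong (λ c → (n ∸ c) % 2 ≡ᵇ 0) (begin
    cycles (inverse σ)                    ≡⟨ cycles-as-sumFin (inverse σ) ⟩
    ∑[ i < n ] 𝟙 (isCycleMinᵇ (inverse σ) i) ≡⟨ sumFin-cong n (cong 𝟙 ∘ isCycleMinᵇ-inverse) ⟩
    ∑[ i < n ] 𝟙 (isCycleMinᵇ σ i)         ≡⟨ cycles-as-sumFin σ ⟨
    cycles σ                              ∎)
    where open ≡-Reasoning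

  -- For a derangement, x ↦ σ(x) turns the excedances of σ⁻¹ into the anti-excedances of σ.
  exc-inverse : IsDerangement σ → exc (inverse σ) ≡ n ∸ exc σ
  exc-inverse der = trans (sym (m+n∸n≡m (exc (inverse σ)) (exc σ))) (cong (_∸ exc σ) (begin
    exc (inverse σ) + exc σ
      ≡⟨ cong₂ _+_ (length-filterᵇ _ (allFin n)) (length-filterᵇ _ (allFin n)) ⟩
    ∑[ x ∈ allFin n ] 𝟙 (toℕ x <ᵇ toℕ (app (inverse σ) x)) + ∑[ y ∈ allFin n ] 𝟙 (toℕ y <ᵇ toℕ (app σ y))
      ≡⟨ cong (_+ exc-σ) (∑-𝟙-bijection reindex (allFin-enumerates n) (allFin-enumerates n)) ⟩
    ∑[ y ∈ allFin n ] 𝟙 (toℕ (app σ y) <ᵇ toℕ y) + ∑[ y ∈ allFin n ] 𝟙 (toℕ y <ᵇ toℕ (app σ y))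
      ≡⟨ ∑-distrib-+ (allFin n) _ _ ⟨
    ∑[ y ∈ allFin n ] (𝟙 (toℕ (app σ y) <ᵇ toℕ y) + 𝟙 (toℕ y <ᵇ toℕ (app σ y)))
      ≡⟨ ∑-cong (allFin n) (λ y → 𝟙<ᵇ+𝟙>ᵇ≡1 (der y ∘ toℕ-injective)) ⟩
    ∑[ y ∈ allFin n ] 1
      ≡⟨ trans (∑-tabulate {n = n} id (λ _ → 1)) (sumFin-const-1 n) ⟩
    n ∎))
    where
    open ≡-Reasoning
    exc-σ : ℕ
    exc-σ = ∑[ y ∈ allFin n ] 𝟙 (toℕ y <ᵇ toℕ (app σ y))
    reindex : PartialBijection (λ x → toℕ x <ᵇ toℕ (app (inverse σ) x)) (λ y → toℕ (app σ y) <ᵇ toℕ y)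
    reindex = record
      { to       = app (inverse σ)
      ; from     = app σ
      ; to-sat   = λ {x} → subst (λ z → T (toℕ z <ᵇ toℕ (app (inverse σ) x))) (sym (inverseʳ x))
      ; from-sat = λ {y} → subst (λ z → T (toℕ (app σ y) <ᵇ toℕ z)) (sym (inverseˡ y))
      ; from∘to  = λ {x} _ → inverseʳ x
      ; to∘from  = λ {y} _ → inverseˡ y
      }

  inverse-isParityAlternating : IsParityAlternating σ → IsParityAlternating (inverse σ)
  inverse-isParityAlternating pap x = trans (sym (pap (app (inverse σ) x))) (cong (λ y → toℕ y % 2) (inverseʳ x))

  inverse-isDerangement : IsDerangement σ → IsDerangement (inverse σ)
  inverse-isDerangement der x ρx≡x = der x (trans (cong (app σ) (sym ρx≡x)) (inverseʳ x))

inverse-involutive : ∀ {n} (σ : Endo n) → Injective _≡_ _≡_ (app σ) → inverse (inverse σ) ≡ σ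
inverse-involutive σ inj = ≗-lookup⇒≡ λ x →
  inverse-injective (trans (Inverse.inverseʳ (inverse σ) inverse-injective x) (sym (inverseˡ x)))
  where open Inverse σ inj

-- Pⱼ, Dⱼ, Xⱼ, Eⱼ stand for the permutation test, derangement test, excedance number and evenness of
-- the two halves; X₁ + X₂ = k is split according to the value i ≥ 1 of X₁.
𝟙-convolution : ∀ k (P₁ P₂ D₁ D₂ : Bool) (X₁ X₂ : ℕ) (E₁ E₂ e : Bool) →
  (T (P₁ ∧ D₁) → 1 ≤ X₁) → (T (P₂ ∧ D₂) → 1 ≤ X₂) →
  𝟙 ((P₁ ∧ P₂) ∧ (D₁ ∧ D₂) ∧ (X₁ + X₂ ≡ᵇ k) ∧ xnor (xnor E₁ E₂) e)
  ≡ sum1to (k ∸ 1) (λ i → 𝟙 (P₁ ∧ D₁ ∧ (X₁ ≡ᵇ i) ∧ xnor E₁ true)  * 𝟙 (P₂ ∧ D₂ ∧ (X₂ ≡ᵇ k ∸ i) ∧ xnor E₂ e)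
                        + 𝟙 (P₁ ∧ D₁ ∧ (X₁ ≡ᵇ i) ∧ xnor E₁ false) * 𝟙 (P₂ ∧ D₂ ∧ (X₂ ≡ᵇ k ∸ i) ∧ xnor E₂ (not e)))
𝟙-convolution k false _     _    _     _ _ _ _ _ _ _ = sym (sum1to-zero (k ∸ 1) (λ _ → refl))
𝟙-convolution k true  false D₁   _     X₁ _ E₁ _ _ _ _ = sym (sum1to-zero (k ∸ 1) λ i →
  cong₂ _+_ (*-zeroʳ (𝟙 (D₁ ∧ (X₁ ≡ᵇ i) ∧ xnor E₁ true))) (*-zeroʳ (𝟙 (D₁ ∧ (X₁ ≡ᵇ i) ∧ xnor E₁ false))))
𝟙-convolution k true  true  false _     _ _ _ _ _ _ _ = sym (sum1to-zero (k ∸ 1) (λ _ → refl))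
𝟙-convolution k true  true  true  false X₁ _ E₁ _ _ _ _ = sym (sum1to-zero (k ∸ 1) λ i →
  cong₂ _+_ (*-zeroʳ (𝟙 ((X₁ ≡ᵇ i) ∧ xnor E₁ true))) (*-zeroʳ (𝟙 ((X₁ ≡ᵇ i) ∧ xnor E₁ false))))
𝟙-convolution k true  true  true  true  X₁ X₂ true E₂ e pos₁ pos₂ =
  trans (𝟙-+≡ᵇ-as-sum1to k X₁ X₂ (xnor E₂ e) (pos₁ _) (pos₂ _)) (sum1to-cong (k ∸ 1) λ i → sym (trans
    (cong₂ _+_ (cong (_* 𝟙 ((X₂ ≡ᵇ k ∸ i) ∧ xnor E₂ e)) (𝟙-∧-true (X₁ ≡ᵇ i)))
               (cong (_* 𝟙 ((X₂ ≡ᵇ k ∸ i) ∧ xnor E₂ (not e))) (𝟙-∧-false (X₁ ≡ᵇ i))))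
    (+-identityʳ _)))
𝟙-convolution k true  true  true  true  X₁ X₂ false E₂ e pos₁ pos₂ =
  trans (cong (λ b → 𝟙 ((X₁ + X₂ ≡ᵇ k) ∧ b)) (xnor-not E₂ e))
  (trans (𝟙-+≡ᵇ-as-sum1to k X₁ X₂ (xnor E₂ (not e)) (pos₁ _) (pos₂ _)) (sum1to-cong (k ∸ 1) λ i → sym (
    cong₂ _+_ (cong (_* 𝟙 ((X₂ ≡ᵇ k ∸ i) ∧ xnor E₂ e)) (𝟙-∧-false (X₁ ≡ᵇ i)))
              (cong (_* 𝟙 ((X₂ ≡ᵇ k ∸ i) ∧ xnor E₂ (not e))) (𝟙-∧-true (X₁ ≡ᵇ i))))))

exc-positive : ∀ {m} (τ : Endo (suc m)) → IsDerangement τ → 1 ≤ exc τ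
exc-positive τ der = subst (1 ≤_) (sym (exc-as-sumFin τ)) (≤-trans (first (app τ zero) (der zero)) (m≤m+n _ _))
  where
  first : ∀ {m} (x : Fin (suc m)) → x ≢ zero → 1 ≤ 𝟙 (0 <ᵇ toℕ x)
  first zero    x≢0 = ⊥-elim (x≢0 refl)
  first (suc _) _   = s≤s z≤n

papWith⇒injective : ∀ {n k e} {σ : Endo n} → T (papWith k e σ) → Injective _≡_ _≡_ (app σ)
papWith⇒injective {σ = σ} h = isPermᵇ-sound σ (proj₁ (T-∧⁻ {isPermᵇ σ} h))

papWith⇒isParityAlternating : ∀ {n k e} {σ : Endo n} → T (papWith k e σ) → IsParityAlternating σ
papWith⇒isParityAlternating {σ = σ} h = isPAPᵇ-sound σ (proj₁ (T-∧⁻ {isPAPᵇ σ} (proj₂ (T-∧⁻ {isPermᵇ σ} h))))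

interleaving-bijection : ∀ {n} k e → PartialBijection (papWith {n} k e) (papWith k e ∘ uncurry interleave)
interleaving-bijection k e = record
  { to       = deinterleave
  ; from     = uncurry interleave
  ; to-sat   = λ {σ} h → subst (T ∘ papWith k e) (sym (interleave∘deinterleave σ (papWith⇒isParityAlternating {σ = σ} h))) h
  ; from-sat = id
  ; from∘to  = λ {σ} h → interleave∘deinterleave σ (papWith⇒isParityAlternating {σ = σ} h)
  ; to∘from  = λ {τ} _ → deinterleave∘interleave (proj₁ τ) (proj₂ τ)
  }

𝟙-papWith-interleave : ∀ {n} k e (τ₁ : Endo ⌈ n /2⌉) (τ₂ : Endo ⌊ n /2⌋) → 2 ≤ n →
  𝟙 (papWith k e (interleave τ₁ τ₂)) ≡ sum1to (k ∸ 1) (λ i →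
      𝟙 (derangementWith i true  τ₁) * 𝟙 (derangementWith (k ∸ i) e       τ₂)
    + 𝟙 (derangementWith i false τ₁) * 𝟙 (derangementWith (k ∸ i) (not e) τ₂))
𝟙-papWith-interleave {suc zero} k e τ₁ τ₂ (s≤s ())
𝟙-papWith-interleave {suc (suc n)} k e τ₁ τ₂ _ = trans
  (cong 𝟙 (Interleaving.papWith-≡ (interleave-isInterleaving τ₁ τ₂) k e))
  (𝟙-convolution k (isPermᵇ τ₁) (isPermᵇ τ₂) (isDerangementᵇ τ₁) (isDerangementᵇ τ₂)
                   (exc τ₁) (exc τ₂) (isEvenᵇ τ₁) (isEvenᵇ τ₂) e
    (λ h → exc-positive τ₁ (isDerangementᵇ-sound τ₁ (proj₂ (T-∧⁻ {isPermᵇ τ₁} h))))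
    (λ h → exc-positive τ₂ (isDerangementᵇ-sound τ₂ (proj₂ (T-∧⁻ {isPermᵇ τ₂} h)))))

-- In d-sign and pd-sign the left-hand side is the sign comparison local to d and pd in Defs, which cannot
-- be named here; it is solved from the use in the same mutual block.
mutual
  d-as-∑ : ∀ e m i → d e m i ≡ ∑[ τ ∈ allMaps m m ] 𝟙 (derangementWith i e τ)
  d-as-∑ e m i = trans (length-filterᵇ-filterᵇ _ isPermᵇ (allMaps m m)) (∑-cong (allMaps m m) λ τ →
    cong (λ s → 𝟙 (isPermᵇ τ ∧ isDerangementᵇ τ ∧ (exc τ ≡ᵇ i) ∧ s)) (d-sign e m i τ))

  d-sign : ∀ e m i (τ : Endo m) → _ ≡ xnor (isEvenᵇ τ) e
  d-sign e m i τ with isEvenᵇ τ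
  ... | true  = refl
  ... | false = refl

mutual
  pd-as-∑ : ∀ e n k → pd e n k ≡ ∑[ σ ∈ allMaps n n ] 𝟙 (papWith k e σ)
  pd-as-∑ e n k = trans (length-filterᵇ-filterᵇ _ isPermᵇ (allMaps n n)) (∑-cong (allMaps n n) λ σ →
    cong (λ s → 𝟙 (isPermᵇ σ ∧ isPAPᵇ σ ∧ isDerangementᵇ σ ∧ (exc σ ≡ᵇ k) ∧ s)) (pd-sign e n k σ))

  pd-sign : ∀ e n k (σ : Endo n) → _ ≡ xnor (isEvenᵇ σ) e
  pd-sign e n k σ with isEvenᵇ σ
  ... | true  = refl
  ... | false = refl

pd-convolution : ∀ {n} k e → 2 ≤ n → pd e n k ≡ sum1to (k ∸ 1) (λ i →
  d true ⌈ n /2⌉ i * d e ⌊ n /2⌋ (k ∸ i) + d false ⌈ n /2⌉ i * d (not e) ⌊ n /2⌋ (k ∸ i))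
pd-convolution {n} k e 2≤n = begin
  pd e n k
    ≡⟨ pd-as-∑ e n k ⟩
  ∑[ σ ∈ allMaps n n ] 𝟙 (papWith k e σ)
    ≡⟨ ∑-𝟙-bijection (interleaving-bijection k e)
         (allMaps-enumerates n n) (cartesianProduct-enumerates (allMaps-enumerates a a) (allMaps-enumerates b b)) ⟩
  ∑[ τ ∈ cartesianProduct Ts₁ Ts₂ ] 𝟙 (papWith k e (uncurry interleave τ))
    ≡⟨ ∑-cartesianProduct Ts₁ Ts₂ _ ⟩
  ∑[ τ₁ ∈ Ts₁ ] ∑[ τ₂ ∈ Ts₂ ] 𝟙 (papWith k e (interleave τ₁ τ₂))
    ≡⟨ ∑-cong Ts₁ (λ τ₁ → ∑-cong Ts₂ (λ τ₂ → 𝟙-papWith-interleave k e τ₁ τ₂ 2≤n)) ⟩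
  ∑[ τ₁ ∈ Ts₁ ] ∑[ τ₂ ∈ Ts₂ ] sum1to (k ∸ 1) (term τ₁ τ₂)
    ≡⟨ ∑-cong Ts₁ (λ τ₁ → ∑-sum1to-comm Ts₂ (k ∸ 1) (term τ₁)) ⟩
  ∑[ τ₁ ∈ Ts₁ ] sum1to (k ∸ 1) (λ i → ∑[ τ₂ ∈ Ts₂ ] term τ₁ τ₂ i)
    ≡⟨ ∑-sum1to-comm Ts₁ (k ∸ 1) _ ⟩
  sum1to (k ∸ 1) (λ i → ∑[ τ₁ ∈ Ts₁ ] ∑[ τ₂ ∈ Ts₂ ] term τ₁ τ₂ i)
    ≡⟨ sum1to-cong (k ∸ 1) factor ⟩
  sum1to (k ∸ 1) (λ i → d true a i * d e b (k ∸ i) + d false a i * d (not e) b (k ∸ i)) ∎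
  where
  open ≡-Reasoning
  a = ⌈ n /2⌉
  b = ⌊ n /2⌋
  Ts₁ = allMaps a a
  Ts₂ = allMaps b b
  term : Endo a → Endo b → ℕ → ℕ
  term τ₁ τ₂ i = 𝟙 (derangementWith i true  τ₁) * 𝟙 (derangementWith (k ∸ i) e       τ₂)
               + 𝟙 (derangementWith i false τ₁) * 𝟙 (derangementWith (k ∸ i) (not e) τ₂)
  factor : ∀ i → ∑[ τ₁ ∈ Ts₁ ] ∑[ τ₂ ∈ Ts₂ ] term τ₁ τ₂ i
                 ≡ d true a i * d e b (k ∸ i) + d false a i * d (not e) b (k ∸ i)
  factor i = trans
    (∑-product-+ Ts₁ Ts₂ (𝟙 ∘ derangementWith i true) (𝟙 ∘ derangementWith (k ∸ i) e)
                         (𝟙 ∘ derangementWith i false) (𝟙 ∘ derangementWith (k ∸ i) (not e)))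
    (sym (cong₂ _+_ (cong₂ _*_ (d-as-∑ true a i) (d-as-∑ e b (k ∸ i)))
                    (cong₂ _*_ (d-as-∑ false a i) (d-as-∑ (not e) b (k ∸ i)))))

papWith-inverse : ∀ {n k e} (σ : Endo n) → T (papWith k e σ) → T (papWith (n ∸ k) e (inverse σ))
papWith-inverse {n} {k} {e} σ h =
  let perm , h₁   = T-∧⁻ {isPermᵇ σ} h
      pap  , h₂   = T-∧⁻ {isPAPᵇ σ} h₁
      der  , h₃   = T-∧⁻ {isDerangementᵇ σ} h₂
      exc≡k , sgn = T-∧⁻ {exc σ ≡ᵇ k} h₃
      open Inverse σ (isPermᵇ-sound σ perm)
  in T-∧⁺ (isPermᵇ-complete (inverse σ) inverse-injective)
    (T-∧⁺ (isPAPᵇ-complete (inverse σ) (inverse-isParityAlternating (isPAPᵇ-sound σ pap)))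
    (T-∧⁺ (isDerangementᵇ-complete (inverse σ) (inverse-isDerangement (isDerangementᵇ-sound σ der)))
    (T-∧⁺ (≡⇒≡ᵇ (exc (inverse σ)) (n ∸ k)
            (trans (exc-inverse (isDerangementᵇ-sound σ der)) (cong (n ∸_) (≡ᵇ⇒≡ (exc σ) k exc≡k))))
          (subst (λ E → T (xnor E e)) (sym isEvenᵇ-inverse) sgn))))

pd-complement : ∀ {n k} e → k ≤ n → pd e n k ≡ pd e n (n ∸ k)
pd-complement {n} {k} e k≤n = begin
  pd e n k                                   ≡⟨ pd-as-∑ e n k ⟩
  ∑[ σ ∈ allMaps n n ] 𝟙 (papWith k e σ)       ≡⟨ ∑-𝟙-bijection inversion
                                                   (allMaps-enumerates n n) (allMaps-enumerates n n) ⟩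
  ∑[ σ ∈ allMaps n n ] 𝟙 (papWith (n ∸ k) e σ) ≡⟨ pd-as-∑ e n (n ∸ k) ⟨
  pd e n (n ∸ k)                             ∎
  where
  open ≡-Reasoning
  inversion : PartialBijection (papWith k e) (papWith (n ∸ k) e)
  inversion = record
    { to       = inverse
    ; from     = inverse
    ; to-sat   = λ {σ} → papWith-inverse σ
    ; from-sat = λ {σ} h → subst (λ k′ → T (papWith k′ e (inverse σ))) (m∸[m∸n]≡n k≤n) (papWith-inverse σ h)
    ; from∘to  = λ {σ} h → inverse-involutive σ (papWith⇒injective {k = k} {e} {σ} h)
    ; to∘from  = λ {σ} h → inverse-involutive σ (papWith⇒injective {k = n ∸ k} {e} {σ} h)
    }

corollary3 : (n k : ℕ) → 4 ≤ n → 2 ≤ k → k ≤ n ∸ 2 →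
    ((k ≤ ⌊ n /2⌋ →
       (𝔡ᵉ n k ≡ sum1to (k ∸ 1) (λ i → dᵉ ⌈ n /2⌉ i * dᵉ ⌊ n /2⌋ (k ∸ i) + dᵒ ⌈ n /2⌉ i * dᵒ ⌊ n /2⌋ (k ∸ i)))
       × (𝔡ᵒ n k ≡ sum1to (k ∸ 1) (λ i → dᵉ ⌈ n /2⌉ i * dᵒ ⌊ n /2⌋ (k ∸ i) + dᵒ ⌈ n /2⌉ i * dᵉ ⌊ n /2⌋ (k ∸ i))))
    × (⌊ n /2⌋ < k →
       (𝔡ᵉ n k ≡ sum1to (n ∸ k ∸ 1) (λ i → dᵉ ⌈ n /2⌉ i * dᵉ ⌊ n /2⌋ (n ∸ k ∸ i) + dᵒ ⌈ n /2⌉ i * dᵒ ⌊ n /2⌋ (n ∸ k ∸ i)))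
       × (𝔡ᵒ n k ≡ sum1to (n ∸ k ∸ 1) (λ i → dᵉ ⌈ n /2⌉ i * dᵒ ⌊ n /2⌋ (n ∸ k ∸ i) + dᵒ ⌈ n /2⌉ i * dᵉ ⌊ n /2⌋ (n ∸ k ∸ i)))))
corollary3 n k 4≤n _ k≤n∸2 =
  (λ _ → pd-convolution k true 2≤n , pd-convolution k false 2≤n) ,
  (λ _ → trans (pd-complement true k≤n) (pd-convolution (n ∸ k) true 2≤n)
       , trans (pd-complement false k≤n) (pd-convolution (n ∸ k) false 2≤n))
  where
  2≤n : 2 ≤ n
  2≤n = ≤-trans (s≤s (s≤s z≤n)) 4≤n
  k≤n : k ≤ n
  k≤n = ≤-trans k≤n∸2 (m∸n≤m n 2)
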